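{- Let $U$ be a set, let $X=\{x_1,\dots,x_m\}$ and $Y=\{y_1,\dots,y_n\}$ be finite nonempty sets, and let $f: X\times Y\to P(U)$. Suppose $(x^*,y^*)\in X\times Y$ is such that $\bigcup_{i=1}^m f(x_i,y^*)=f(x^*,y^*)$ and $\bigcap_{j=1}^n f(x^*,y_j)=f(x^*,y^*)$ (i.e. $f(x^*,y^*)$ is a soft saddle point). Let $\underline{v}=\bigcup_{x\in X}\bigcap_{y\in Y} f(x,y)$ and $\overline{v}=\bigcap_{y\in Y}\bigcup_{x\in X} f(x,y)$. Then $\underline{v}\subseteq f(x^*,y^*)\subseteq\overline{v}$.
   Context: $f$ is the soft payoff function of a two person soft game. A soft saddle point is a value $f(x^*,y^*)$ which equals the union of the column $y^*$ over all rows and the intersection of the row $x^*$ over all columns. $\underline{v}$ and $\overline{v}$ are the soft lower and soft upper values. -}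

module Defs where

open import Level using (Level; _⊔_)
open import Data.Nat using (ℕ)
open import Data.Fin using (Fin)
open import Data.Product using (Σ; ∃; _×_)
open import Relation.Unary using (Pred; _⊆_)

⋃ : ∀ {a ℓ} {U : Set a} {k : ℕ} → (Fin k → Pred U ℓ) → Pred U ℓ
⋃ {k = k} A u = Σ (Fin k) (λ i → A i u)

⋂ : ∀ {a ℓ} {U : Set a} {k : ℕ} → (Fin k → Pred U ℓ) → Pred U ℓ
⋂ {k = k} A u = (i : Fin k) → A i u

_≐_ : ∀ {a ℓ} {U : Set a} → Pred U ℓ → Pred U ℓ → Set (a ⊔ ℓ)
A ≐ B = (A ⊆ B) × (B ⊆ A)

IsSoftSaddlePoint : ∀ {a ℓ} {U : Set a} {m n : ℕ} →
  (Fin m → Fin n → Pred U ℓ) → Fin m → Fin n → Set (a ⊔ ℓ)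
IsSoftSaddlePoint f x* y* =
  (⋃ (λ i → f i y*) ≐ f x* y*) × (⋂ (λ j → f x* j) ≐ f x* y*)

lowerValue : ∀ {a ℓ} {U : Set a} {m n : ℕ} → (Fin m → Fin n → Pred U ℓ) → Pred U ℓ
lowerValue f = ⋃ (λ x → ⋂ (λ y → f x y))

upperValue : ∀ {a ℓ} {U : Set a} {m n : ℕ} → (Fin m → Fin n → Pred U ℓ) → Pred U ℓ
upperValue f = ⋂ (λ y → ⋃ (λ x → f x y))

module Submission where

-- The two inclusions  v̲ ⊆ f(x*,y*) ⊆ v̄  follow from the elementary
-- facts that an indexed intersection lies inside each of its members,
-- each member lies inside the indexed union, and ⋃ / ⋂ are monotone.
--   * Lower bound: for every row x, ⋂_y f(x,y) ⊆ f(x,y*) ⊆ ⋃_i f(i,y*),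
--     and the saddle condition identifies the latter with f(x*,y*);
--     taking the union over x gives v̲ ⊆ f(x*,y*).
--   * Upper bound: the saddle condition gives f(x*,y*) ⊆ ⋂_j f(x*,j),
--     and for every column y, f(x*,y) ⊆ ⋃_x f(x,y); taking the
--     intersection over y gives f(x*,y*) ⊆ v̄.

open import Defs
open import Level using (Level)
open import Data.Nat using (ℕ; suc)
open import Data.Fin using (Fin)
open import Data.Product using (_×_; _,_)
open import Relation.Unary using (Pred; _⊆_)

private
  variable
    a ℓ : Level
    U : Set a
    k : ℕ

member⊆⋃ : (A : Fin k → Pred U ℓ) (i : Fin k) → A i ⊆ ⋃ A
member⊆⋃ A i Aiu = i , Aiu

⋂⊆member : (A : Fin k → Pred U ℓ) (i : Fin k) → ⋂ A ⊆ A i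
⋂⊆member A i ⋂Au = ⋂Au i

⋃-least : (A : Fin k → Pred U ℓ) (B : Pred U ℓ) →
  (∀ i → A i ⊆ B) → ⋃ A ⊆ B
⋃-least A B A⊆B (i , Aiu) = A⊆B i Aiu

⋂-greatest : (A : Fin k → Pred U ℓ) (B : Pred U ℓ) →
  (∀ i → B ⊆ A i) → B ⊆ ⋂ A
⋂-greatest A B B⊆A Bu i = B⊆A i Bu

mainTheorem7 : ∀ {a ℓ} {U : Set a} (m n : ℕ)
    (f : Fin (suc m) → Fin (suc n) → Pred U ℓ)
    (x* : Fin (suc m)) (y* : Fin (suc n)) →
    IsSoftSaddlePoint f x* y* →
    (lowerValue f ⊆ f x* y*) × (f x* y* ⊆ upperValue f)
mainTheorem7 m n f x* y* ((column⊆saddle , _) , (_ , saddle⊆row)) =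
  lowerBound , upperBound
  where
  -- Every row minimum lies in column y*, hence in f(x*,y*).
  lowerBound : lowerValue f ⊆ f x* y*
  lowerBound = ⋃-least (λ x → ⋂ (f x)) (f x* y*) λ x rowMin →
    column⊆saddle (member⊆⋃ (λ i → f i y*) x (⋂⊆member (f x) y* rowMin))

  -- f(x*,y*) lies in every entry of row x*, hence in every column maximum.
  upperBound : f x* y* ⊆ upperValue f
  upperBound = ⋂-greatest (λ y → ⋃ (λ x → f x y)) (f x* y*) λ y saddle →
    member⊆⋃ (λ x → f x y) x* (⋂⊆member (f x*) y (saddle⊆row saddle))
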